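{- For all functions $\kappa,\kappa':\mathbb{N}\to\mathbb{N}$ and all $n\in\mathbb{N}$, $L(\kappa\circ\kappa',n)=L(\kappa',L(\kappa,n))$.
   Context: Untyped modal transformations are functions $\kappa:\mathbb{N}\to\mathbb{N}$. Truncation: $(\kappa|_n)(m)=\kappa(n+m)$. Truncation offset: $L(\kappa,0)=0$, $L(\kappa,1+n)=\kappa(0)+L(\kappa|_1,n)$. Composition (not ordinary function composition) is defined by $(\kappa\circ\kappa')(0)=L(\kappa',\kappa(0))$ and $(\kappa\circ\kappa')(1+n)=((\kappa|_1)\circ(\kappa'|_{\kappa(0)}))(n)$ (by recursion on the argument). -}

module Defs where

open import Data.Nat using (ℕ; zero; suc; _+_)

MT : Set
MT = ℕ → ℕ

_∣_ : MT → ℕ → MT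
(κ ∣ n) m = κ (n + m)

L : MT → ℕ → ℕ
L κ zero = 0
L κ (suc n) = κ 0 + L (κ ∣ 1) n

_⊚_ : MT → MT → MT
(κ ⊚ κ') zero = L κ' (κ 0)
(κ ⊚ κ') (suc n) = ((κ ∣ 1) ⊚ (κ' ∣ κ 0)) n

{-# OPTIONS --safe #-}
-- Induction on n: the first step of κ ⊚ κ' consumes L κ' (κ 0) and continues with κ'
-- truncated at κ 0, so it suffices that L is additive along truncation.
module Submission where

open import Defs
open import Data.Nat using (ℕ; zero; suc; _+_)
open import Data.Nat.Properties using (+-assoc)
open import Relation.Binary.PropositionalEquality using (_≡_; refl; cong; sym; module ≡-Reasoning)

L-+-∣ : (κ : ℕ → ℕ) (a b : ℕ) → L κ (a + b) ≡ L κ a + L (κ ∣ a) b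
L-+-∣ κ zero    b = refl
L-+-∣ κ (suc a) b = begin
  κ 0 + L (κ ∣ 1) (a + b)                     ≡⟨ cong (κ 0 +_) (L-+-∣ (κ ∣ 1) a b) ⟩
  κ 0 + (L (κ ∣ 1) a + L ((κ ∣ 1) ∣ a) b)     ≡⟨ sym (+-assoc (κ 0) _ _) ⟩
  κ 0 + L (κ ∣ 1) a + L (κ ∣ suc a) b         ∎
  where open ≡-Reasoning

lemma6p10 : (κ κ' : ℕ → ℕ) (n : ℕ) → L (κ ⊚ κ') n ≡ L κ' (L κ n)
lemma6p10 κ κ' zero    = refl
lemma6p10 κ κ' (suc n) = begin
  L κ' (κ 0) + L ((κ ∣ 1) ⊚ (κ' ∣ κ 0)) n     ≡⟨ cong (L κ' (κ 0) +_) (lemma6p10 (κ ∣ 1) (κ' ∣ κ 0) n) ⟩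
  L κ' (κ 0) + L (κ' ∣ κ 0) (L (κ ∣ 1) n)     ≡⟨ sym (L-+-∣ κ' (κ 0) (L (κ ∣ 1) n)) ⟩
  L κ' (κ 0 + L (κ ∣ 1) n)                    ∎
  where open ≡-Reasoning
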